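{- Let $c$ be a $d$-dimensional finitary integral configuration and $f\in\operatorname{Ann}(c)$ a non-zero polynomial with integer coefficients. Then there exists an integer $r$ such that for every positive integer $n$ relatively prime to $r$ we have $f(X^n)\in\operatorname{Ann}(c)$.
   Context: A $d$-dimensional configuration is a formal power series $c=\sum_{\vec v\in\mathbb{Z}^d}c_{\vec v}X^{\vec v}$ with complex coefficients, $X^{\vec v}=x_1^{v_1}\cdots x_d^{v_d}$; it is integral if all $c_{\vec v}\in\mathbb{Z}$ and finitary if only finitely many distinct values occur. For a polynomial $f=\sum a_{\vec u}X^{\vec u}$, $(fc)_{\vec v}=\sum_{\vec u}a_{\vec u}c_{\vec v-\vec u}$, and $\operatorname{Ann}(c)=\{f\in\mathbb{C}[x_1,\dots,x_d]: fc=0\}$. For $f(X)=\sum a_{\vec v}X^{\vec v}$ and a positive integer $n$, $f(X^n)=\sum a_{\vec v}X^{n\vec v}$. -}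

module Defs where

open import Data.Nat using (ℕ)
open import Data.Integer using (ℤ; +_; _+_; _-_; _*_)
open import Data.Vec using (Vec; zipWith; map)
import Data.Vec.Properties as VecP
open import Data.Nat.Properties using () renaming (_≟_ to _≟ℕ_)
open import Data.List using (List; []; _∷_)
open import Data.List.Membership.Propositional using (_∈_)
open import Data.Product using (_×_; _,_; ∃)
open import Relation.Nullary using (yes; no)
open import Relation.Binary.PropositionalEquality using (_≡_)
import Data.Nat as ℕ

Configuration : ℕ → Set
Configuration d = Vec ℤ d → ℤ

-- Finitary: only finitely many distinct values occur (all values lie in some finite list).
Finitary : ∀ {d} → Configuration d → Set
Finitary c = ∃ λ (L : List ℤ) → ∀ v → c v ∈ L

-- A polynomial in ℤ[x_1,…,x_d], written as a finite formal sum of terms a·X^u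
-- (u ∈ ℕ^d an exponent vector, a ∈ ℤ). Repeated exponents are allowed; they add up.
Poly : ℕ → Set
Poly d = List (Vec ℕ d × ℤ)

coeff : ∀ {d} → Poly d → Vec ℕ d → ℤ
coeff [] u = + 0
coeff ((w , a) ∷ f) u with VecP.≡-dec _≟ℕ_ w u
... | yes _ = a + coeff f u
... | no  _ = coeff f u

NonZeroPoly : ∀ {d} → Poly d → Set
NonZeroPoly f = ∃ λ u → (coeff f u ≡ + 0 → Data.Empty.⊥)
  where import Data.Empty

_−ᵥ_ : ∀ {d} → Vec ℤ d → Vec ℕ d → Vec ℤ d
v −ᵥ u = zipWith (λ a b → a - + b) v u

act : ∀ {d} → Poly d → Configuration d → Configuration d
act [] c v = + 0
act ((u , a) ∷ f) c v = a * c (v −ᵥ u) + act f c v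

_∈Ann_ : ∀ {d} → Poly d → Configuration d → Set
f ∈Ann c = ∀ v → act f c v ≡ + 0

dilate : ∀ {d} → ℕ → Poly d → Poly d
dilate n [] = []
dilate n ((u , a) ∷ f) = (map (n ℕ.*_) u , a) ∷ dilate n f

module Submission where

-- Let |c| ≤ M (a finitary configuration takes finitely many values) and f·c = 0.
-- For a prime p the operators of f^p and f(X^p) on configurations are congruent
-- mod p (freshman's dream plus Fermat's little theorem), so every value of
-- f(X^p)·c is ≡ 0 mod p, the corresponding value of f^p·c being 0.  Those values
-- have absolute value at most B = weight f · M (weight f = Σ |aᵤ|), so they vanish
-- once p > B.  Dilation is multiplicative and preserves the weight; iterating over
-- the prime factorisation of n, f(X^n)·c = 0 whenever n is coprime to r = B!.

open import Data.Nat as ℕ using (ℕ; zero; suc; _≤_; _<_; _!; _∸_; NonZero)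
import Data.Nat.Properties as ℕP
open import Data.Nat.Divisibility
  using (_∣_; divides; ∣1⇒≡1; ∣⇒≤; ∣-refl; ∣-trans; m∣m*n; n∣m*n; m≤n⇒m!∣n!)
open import Data.Nat.DivMod using (m/n*n≡m)
open import Data.Nat.Coprimality using (Coprime)
open import Data.Nat.Primality using (Prime; euclidsLemma; prime⇒nonZero; prime⇒nonTrivial)
open import Data.Nat.Primality.Factorisation using (factorise; PrimeFactorisation)
open import Data.Nat.Combinatorics using (_C_; nCn≡1; nCk≡n!/k![n-k]!; k![n∸k]!∣n!)
open import Data.Nat.ListAction using (product)
import Data.Integer.Properties as ℤP
open import Data.Integer.Tactic.RingSolver using (solve-∀)
open import Data.Fin using (Fin; zero; suc; inject₁; fromℕ)
open import Data.Fin.Properties using (toℕ-inject₁; toℕ<n; toℕ-fromℕ)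
open import Data.Vec using (Vec; []; _∷_; map)
open import Data.List using ([]; _∷_)
open import Data.List.Relation.Unary.All using (All; []; _∷_)
open import Data.Product using (∃; _,_)
open import Data.Sum using (inj₁; inj₂)
open import Relation.Nullary using (yes; no; contradiction)
open import Relation.Binary.PropositionalEquality as ≡ using (_≡_)
open import Algebra.Bundles using (Semiring)
open import Level using (0ℓ; _⊔_)
open import Defs

-- A prime dividing m! is at most m (Euclid's lemma applied to m! = m · (m-1)!).
prime∣!⇒≤ : ∀ {p} m → Prime p → p ∣ m ! → p ≤ m
prime∣!⇒≤ zero    pr p∣1 = contradiction (∣1⇒≡1 p∣1) (ℕ.nonTrivial⇒≢1 {{prime⇒nonTrivial pr}})
prime∣!⇒≤ (suc m) pr p∣m! with euclidsLemma (suc m) (m !) pr p∣m!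
... | inj₁ p∣1+m = ∣⇒≤ p∣1+m
... | inj₂ p∣m!  = ℕP.m≤n⇒m≤1+n (prime∣!⇒≤ m pr p∣m!)

n∣n! : ∀ n .{{_ : NonZero n}} → n ∣ n !
n∣n! (suc n) = m∣m*n (n !)

choose*denominator≡! : ∀ {n k} → k ≤ n → (n C k) ℕ.* (k ! ℕ.* (n ∸ k) !) ≡ n !
choose*denominator≡! {n} {k} k≤n = ≡.trans
  (≡.cong (ℕ._* (k ! ℕ.* (n ∸ k) !)) (nCk≡n!/k![n-k]! k≤n))
  (m/n*n≡m (k![n∸k]!∣n! k≤n))
  where instance _ = ℕP._!*_!≢0 k (n ∸ k)

-- A prime p divides p C k for 0 < k < p: it divides p! but neither k! nor (p-k)!.
prime∣choose : ∀ {p k} → Prime p → 0 < k → k < p → p ∣ p C k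
prime∣choose {p} {k} pr 0<k k<p
  with euclidsLemma (p C k) (k ! ℕ.* (p ∸ k) !) pr
         (≡.subst (p ∣_) (≡.sym (choose*denominator≡! (ℕP.<⇒≤ k<p))) (n∣n! p {{prime⇒nonZero pr}}))
... | inj₁ p∣choose = p∣choose
... | inj₂ p∣denominator with euclidsLemma (k !) ((p ∸ k) !) pr p∣denominator
...   | inj₁ p∣k!     = contradiction (prime∣!⇒≤ k pr p∣k!) (ℕP.<⇒≱ k<p)
...   | inj₂ p∣[p∸k]! = contradiction (prime∣!⇒≤ (p ∸ k) pr p∣[p∸k]!)
                          (ℕP.<⇒≱ (ℕP.∸-monoʳ-< 0<k (ℕP.<⇒≤ k<p)))

module PrimeFactors where
  open import Data.Product using (_×_)

  -- A prime coprime to B! exceeds B, since every positive p ≤ B divides B!.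
  prime-coprime-!⇒> : ∀ {p B} → Prime p → Coprime p (B !) → B < p
  prime-coprime-!⇒> {p} {B} pr p⊥B! with B ℕ.<? p
  ... | yes B<p = B<p
  ... | no  B≮p = contradiction (p⊥B! (∣-refl , p∣B!)) (ℕ.nonTrivial⇒≢1 {{prime⇒nonTrivial pr}})
    where
    p∣B! : p ∣ B !
    p∣B! = ∣-trans (n∣n! p {{prime⇒nonZero pr}}) (m≤n⇒m!∣n! (ℕP.≮⇒≥ B≮p))

  large-prime-factors : ∀ {B} ps → All Prime ps → Coprime (product ps) (B !) →
                        All (λ p → Prime p × B < p) ps
  large-prime-factors []       []         _    = []
  large-prime-factors (p ∷ ps) (pr ∷ prs) Π⊥B! =
    (pr , prime-coprime-!⇒> pr (coprime-∣ (m∣m*n (product ps)) Π⊥B!))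
    ∷ large-prime-factors ps prs (coprime-∣ (n∣m*n p) Π⊥B!)
    where
    coprime-∣ : ∀ {m n k} → m ∣ n → Coprime n k → Coprime m k
    coprime-∣ m∣n n⊥k (d∣m , d∣k) = n⊥k (∣-trans d∣m m∣n , d∣k)

-- The operator semiring below is not a
-- ring, so this is the notion of divisibility by p available there.
module Congruence {a ℓ} (R : Semiring a ℓ) where
  open Semiring R hiding (zero)
  open import Algebra.Properties.Semiring.Mult R using (_×_; ×-assocˡ)
  open import Algebra.Properties.CommutativeMonoid.Mult +-commutativeMonoid using (×-distrib-+)
  open import Algebra.Properties.Semiring.Sum R using (sum; sum-init-last)
  open import Algebra.Properties.Semiring.Exp R using (_^_)
  open import Algebra.Properties.CommutativeSemigroup +-commutativeSemigroup using (interchange)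
  open import Relation.Binary.Reasoning.Setoid setoid

  infix 4 _≈_mod_
  record _≈_mod_ (x y : Carrier) (p : ℕ) : Set (a ⊔ ℓ) where
    constructor differBy
    field
      witness    : Carrier
      difference : x ≈ y + p × witness

  ×-zeroʳ : ∀ n → n × 0# ≈ 0#
  ×-zeroʳ zero    = refl
  ×-zeroʳ (suc n) = trans (+-identityˡ _) (×-zeroʳ n)

  ≈⇒≈mod : ∀ {p x y} → x ≈ y → x ≈ y mod p
  ≈⇒≈mod {p} {x} {y} x≈y = differBy 0# (begin
    x           ≈⟨ x≈y ⟩
    y           ≈⟨ +-identityʳ y ⟨
    y + 0#      ≈⟨ +-congˡ (×-zeroʳ p) ⟨
    y + p × 0#  ∎)

  ≈mod-trans : ∀ {p x y z} → x ≈ y mod p → y ≈ z mod p → x ≈ z mod p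
  ≈mod-trans {p} {x} {y} {z} (differBy u x≈y+pu) (differBy w y≈z+pw) = differBy (w + u) (begin
    x                    ≈⟨ x≈y+pu ⟩
    y + p × u            ≈⟨ +-congʳ y≈z+pw ⟩
    (z + p × w) + p × u  ≈⟨ +-assoc z _ _ ⟩
    z + (p × w + p × u)  ≈⟨ +-congˡ (×-distrib-+ w u p) ⟨
    z + p × (w + u)      ∎)

  ≈mod-+ : ∀ {p x x′ y y′} → x ≈ x′ mod p → y ≈ y′ mod p → x + y ≈ x′ + y′ mod p
  ≈mod-+ {p} {x} {x′} {y} {y′} (differBy u x≈x′+pu) (differBy w y≈y′+pw) = differBy (u + w) (begin
    x + y                        ≈⟨ +-cong x≈x′+pu y≈y′+pw ⟩
    (x′ + p × u) + (y′ + p × w)  ≈⟨ interchange x′ _ y′ _ ⟩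
    (x′ + y′) + (p × u + p × w)  ≈⟨ +-congˡ (×-distrib-+ u w p) ⟨
    (x′ + y′) + p × (u + w)      ∎)

  multiple≈0 : ∀ {p m} x → p ∣ m → m × x ≈ 0# mod p
  multiple≈0 {p} {m} x (divides q m≡q*p) = differBy (q × x) (begin
    m × x             ≡⟨ ≡.cong (_× x) (≡.trans m≡q*p (ℕP.*-comm q p)) ⟩
    (p ℕ.* q) × x     ≈⟨ ×-assocˡ x p q ⟨
    p × (q × x)       ≈⟨ +-identityˡ _ ⟨
    0# + p × (q × x)  ∎)

  sum≈0 : ∀ {p n} (t : Fin n → Carrier) → (∀ i → t i ≈ 0# mod p) → sum t ≈ 0# mod p
  sum≈0 {n = zero}  t t≈0 = ≈⇒≈mod refl
  sum≈0 {n = suc n} t t≈0 =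
    ≈mod-trans (≈mod-+ (t≈0 zero) (sum≈0 (λ i → t (suc i)) (λ i → t≈0 (suc i))))
               (≈⇒≈mod (+-identityˡ 0#))

  -- The freshman's dream: for commuting x, y and a prime p,
  -- (x + y)^p ≈ x^p + y^p mod p.  In the binomial expansion the terms k = 0 and
  -- k = p are y^p and x^p, and p divides every other binomial coefficient.
  freshman : ∀ {p x y} → x * y ≈ y * x → Prime p → (x + y) ^ p ≈ x ^ p + y ^ p mod p
  freshman {p@(suc q)} {x} {y} xy≈yx pr =
    ≈mod-trans (≈⇒≈mod (theorem xy≈yx p))
    (≈mod-trans (≈mod-+ (≈⇒≈mod first) inner+last) (≈⇒≈mod (+-comm (y ^ p) (x ^ p))))
    where
    open import Algebra.Properties.Semiring.Binomial R x y using (theorem; binomialTerm)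
    t = binomialTerm p
    first : t zero ≈ y ^ p
    first = trans (+-identityʳ _) (*-identityˡ _)
    last : t (suc (fromℕ q)) ≈ x ^ p
    last rewrite toℕ-fromℕ q | nCn≡1 p | ℕP.n∸n≡0 p = trans (+-identityʳ _) (*-identityʳ _)
    inner : ∀ j → t (suc (inject₁ j)) ≈ 0# mod p
    inner j = multiple≈0 _ (prime∣choose pr ℕ.z<s
                (ℕ.s<s (≡.subst (ℕ._< q) (≡.sym (toℕ-inject₁ j)) (toℕ<n j))))
    inner+last : sum (λ i → t (suc i)) ≈ x ^ p mod p
    inner+last = ≈mod-trans (≈⇒≈mod (sum-init-last (λ i → t (suc i))))
                 (≈mod-trans (≈mod-+ (sum≈0 _ inner) (≈⇒≈mod last)) (≈⇒≈mod (+-identityˡ _)))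

-- Fermat's little theorem  a^p ≈ a mod p  for all integers a.  By the freshman's
-- dream the integers satisfying it are closed under addition and negation; they
-- contain 0 and 1.
module Fermat where
  open import Data.Integer using (ℤ; +_; -[1+_]; _+_; _*_; -_)
  open Congruence ℤP.+-*-semiring public using (_≈_mod_; differBy; ≈⇒≈mod; ≈mod-trans; ≈mod-+; freshman)
  open import Algebra.Properties.Semiring.Mult ℤP.+-*-semiring using (_×_)
  open import Algebra.Properties.Semiring.Exp ℤP.+-*-semiring using (_^_)

  ×≡* : ∀ n x → n × x ≡ + n * x
  ×≡* zero    x = ≡.sym (ℤP.*-zeroˡ x)
  ×≡* (suc n) x = ≡.trans (≡.cong (λ t → x + t) (×≡* n x)) (≡.sym (ℤP.suc-* (+ n) x))

  1^n≡1 : ∀ n → (+ 1) ^ n ≡ + 1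
  1^n≡1 zero    = ≡.refl
  1^n≡1 (suc n) = ≡.trans (ℤP.*-identityˡ _) (1^n≡1 n)

  0^p≡0 : ∀ {p} → Prime p → (+ 0) ^ p ≡ + 0
  0^p≡0 {suc q} _ = ≡.refl

  FermatFor : ℕ → ℤ → Set
  FermatFor p a = a ^ p ≈ a mod p

  fermat-+ : ∀ {p a b} → Prime p → FermatFor p a → FermatFor p b → FermatFor p (a + b)
  fermat-+ {a = a} {b} pr fa fb = ≈mod-trans (freshman (ℤP.*-comm a b) pr) (≈mod-+ fa fb)

  -- 0 = (-a + a)^p ≡ (-a)^p + a^p ≡ (-a)^p + a, so (-a)^p ≡ -a.
  fermat-neg : ∀ {p a} → Prime p → FermatFor p a → FermatFor p (- a)
  fermat-neg {p} {a} pr (differBy w a^p≡a+pw) with freshman {x = - a} {y = a} (ℤP.*-comm (- a) a) pr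
  ... | differBy z [-a+a]^p≡ = differBy (- (z + w)) (begin
    (- a) ^ p                                                ≡⟨ cancel ((- a) ^ p) a (+ p) z w ⟩
    ((- a) ^ p + (a + + p * w)) + + p * z + (- a + + p * - (z + w))
      ≡⟨ ≡.cong₂ (λ s t → ((- a) ^ p + s) + t + (- a + + p * - (z + w))) (≡.sym a^p≡a+pw′) (≡.sym (×≡* p z)) ⟩
    ((- a) ^ p + a ^ p) + p × z + (- a + + p * - (z + w))
      ≡⟨ ≡.cong (_+ (- a + + p * - (z + w))) (≡.sym [-a+a]^p≡) ⟩
    (- a + a) ^ p + (- a + + p * - (z + w))
      ≡⟨ ≡.cong (_+ (- a + + p * - (z + w))) (≡.trans (≡.cong (_^ p) (ℤP.+-inverseˡ a)) (0^p≡0 pr)) ⟩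
    + 0 + (- a + + p * - (z + w))                            ≡⟨ ℤP.+-identityˡ _ ⟩
    - a + + p * - (z + w)                                    ≡⟨ ≡.cong (λ t → - a + t) (×≡* p (- (z + w))) ⟨
    - a + p × - (z + w)                                      ∎)
    where
    open ≡.≡-Reasoning
    a^p≡a+pw′ : a ^ p ≡ a + + p * w
    a^p≡a+pw′ = ≡.trans a^p≡a+pw (≡.cong (λ t → a + t) (×≡* p w))
    cancel : ∀ u a P z w → u ≡ ((u + (a + P * w)) + P * z) + (- a + P * - (z + w))
    cancel = solve-∀

  fermat-ℕ : ∀ {p} → Prime p → ∀ n → FermatFor p (+ n)
  fermat-ℕ     pr zero    = ≈⇒≈mod (0^p≡0 pr)
  fermat-ℕ {p} pr (suc n) = fermat-+ {a = + 1} pr (≈⇒≈mod (1^n≡1 p)) (fermat-ℕ pr n)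

  fermat : ∀ {p} → Prime p → ∀ a → FermatFor p a
  fermat pr (+ n)    = fermat-ℕ pr n
  fermat pr -[1+ n ] = fermat-neg pr (fermat-ℕ pr (suc n))

-- Configurations are the case V = ℤ^d;
-- this semiring lets us take powers of the operator of a polynomial without
-- defining polynomial multiplication.
module Operators (V : Set) where
  open import Data.Integer using (ℤ; +_; _+_; _*_)
  open import Algebra.Structures using (IsSemiring)
  open import Algebra.Properties.CommutativeSemigroup ℤP.+-commutativeSemigroup using (interchange)
  open ≡ using (_≗_)

  record Op : Set where
    field
      apply      : (V → ℤ) → (V → ℤ)
      apply-cong : ∀ {e e′} → e ≗ e′ → apply e ≗ apply e′
      apply-+    : ∀ e e′ → apply (λ v → e v + e′ v) ≗ λ v → apply e v + apply e′ v
      apply-0    : apply (λ _ → + 0) ≗ λ _ → + 0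
  open Op public

  infix  4 _≈ᵒ_
  infixl 6 _⊕_
  infixl 7 _⊛_

  _≈ᵒ_ : Op → Op → Set
  X ≈ᵒ Y = ∀ e → apply X e ≗ apply Y e

  _⊕_ : Op → Op → Op
  X ⊕ Y = record
    { apply      = λ e v → apply X e v + apply Y e v
    ; apply-cong = λ e≗e′ v → ≡.cong₂ _+_ (apply-cong X e≗e′ v) (apply-cong Y e≗e′ v)
    ; apply-+    = λ e e′ v → ≡.trans (≡.cong₂ _+_ (apply-+ X e e′ v) (apply-+ Y e e′ v))
                                      (interchange (apply X e v) _ _ _)
    ; apply-0    = λ v → ≡.cong₂ _+_ (apply-0 X v) (apply-0 Y v)
    }

  _⊛_ : Op → Op → Op
  X ⊛ Y = record
    { apply      = λ e → apply X (apply Y e)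
    ; apply-cong = λ e≗e′ → apply-cong X (apply-cong Y e≗e′)
    ; apply-+    = λ e e′ v → ≡.trans (apply-cong X (apply-+ Y e e′) v) (apply-+ X (apply Y e) (apply Y e′) v)
    ; apply-0    = λ v → ≡.trans (apply-cong X (apply-0 Y) v) (apply-0 X v)
    }

  𝟘 : Op
  𝟘 = record { apply = λ _ _ → + 0 ; apply-cong = λ _ _ → ≡.refl ; apply-+ = λ _ _ _ → ≡.refl ; apply-0 = λ _ → ≡.refl }

  𝟙 : Op
  𝟙 = record { apply = λ e → e ; apply-cong = λ e≗e′ → e≗e′ ; apply-+ = λ _ _ _ → ≡.refl ; apply-0 = λ _ → ≡.refl }

  -- Every law holds pointwise, by the corresponding law of ℤ or definitionally;
  -- additivity of X gives  X ⊛ (Y ⊕ Z) ≈ X ⊛ Y ⊕ X ⊛ Z  and  X ⊛ 𝟘 ≈ 𝟘.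
  isSemiring : IsSemiring _≈ᵒ_ _⊕_ _⊛_ 𝟘 𝟙
  isSemiring = record
    { isSemiringWithoutAnnihilatingZero = record
      { +-isCommutativeMonoid = record
        { isMonoid = record
          { isSemigroup = record
            { isMagma = record
              { isEquivalence = record
                { refl  = λ _ _ → ≡.refl
                ; sym   = λ X≈Y e v → ≡.sym (X≈Y e v)
                ; trans = λ X≈Y Y≈Z e v → ≡.trans (X≈Y e v) (Y≈Z e v) }
              ; ∙-cong = λ X≈X′ Y≈Y′ e v → ≡.cong₂ _+_ (X≈X′ e v) (Y≈Y′ e v) }
            ; assoc = λ X Y Z e v → ℤP.+-assoc (apply X e v) _ _ }
          ; identity = (λ X e v → ℤP.+-identityˡ _) , (λ X e v → ℤP.+-identityʳ _) }
        ; comm = λ X Y e v → ℤP.+-comm (apply X e v) _ }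
      ; *-cong = λ {X} {X′} {Y} {Y′} X≈X′ Y≈Y′ e v → ≡.trans (apply-cong X (Y≈Y′ e) v) (X≈X′ (apply Y′ e) v)
      ; *-assoc = λ _ _ _ _ _ → ≡.refl
      ; *-identity = (λ _ _ _ → ≡.refl) , (λ _ _ _ → ≡.refl)
      ; distrib = (λ X Y Z e v → apply-+ X (apply Y e) (apply Z e) v) , (λ _ _ _ _ _ → ≡.refl) }
    ; zero = (λ _ _ _ → ≡.refl) , (λ X e v → apply-0 X v) }

  semiring : Semiring 0ℓ 0ℓ
  semiring = record { isSemiring = isSemiring }

  open Congruence semiring public using (_≈_mod_; differBy; ≈⇒≈mod; ≈mod-trans; ≈mod-+; freshman)
  open import Algebra.Properties.Semiring.Mult semiring public using (_×_)
  open import Algebra.Properties.Semiring.Exp semiring public using (_^_)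

  ×-apply : ∀ n X e v → apply (n × X) e v ≡ + n * apply X e v
  ×-apply zero    X e v = ≡.sym (ℤP.*-zeroˡ (apply X e v))
  ×-apply (suc n) X e v = ≡.trans (≡.cong (λ t → apply X e v + t) (×-apply n X e v))
                                  (≡.sym (ℤP.suc-* (+ n) (apply X e v)))

  ≈mod⇒pointwise : ∀ {X Y p} → X ≈ Y mod p → ∀ e v → ∃ λ k → apply X e v ≡ apply Y e v + + p * k
  ≈mod⇒pointwise {Y = Y} {p} (differBy Z X≈Y+pZ) e v =
    apply Z e v , ≡.trans (X≈Y+pZ e v) (≡.cong (λ t → apply Y e v + t) (×-apply p Z e v))

module Shifts where
  open import Data.Integer using (ℤ; +_; _+_; _-_)

  −ᵥ-comm : ∀ {k} (v : Vec ℤ k) (u w : Vec ℕ k) → (v −ᵥ u) −ᵥ w ≡ (v −ᵥ w) −ᵥ u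
  −ᵥ-comm []      []      []      = ≡.refl
  −ᵥ-comm (x ∷ v) (a ∷ u) (b ∷ w) = ≡.cong₂ _∷_ (swap x (+ a) (+ b)) (−ᵥ-comm v u w)
    where
    swap : ∀ x a b → (x - a) - b ≡ (x - b) - a
    swap = solve-∀

  −ᵥ-0* : ∀ {k} (v : Vec ℤ k) (u : Vec ℕ k) → v −ᵥ map (0 ℕ.*_) u ≡ v
  −ᵥ-0* []      []      = ≡.refl
  −ᵥ-0* (x ∷ v) (a ∷ u) = ≡.cong₂ _∷_ (ℤP.+-identityʳ x) (−ᵥ-0* v u)

  −ᵥ-suc* : ∀ {k} n (v : Vec ℤ k) (u : Vec ℕ k) → (v −ᵥ u) −ᵥ map (n ℕ.*_) u ≡ v −ᵥ map (suc n ℕ.*_) u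
  −ᵥ-suc* n []      []      = ≡.refl
  −ᵥ-suc* n (x ∷ v) (a ∷ u) = ≡.cong₂ _∷_ shift (−ᵥ-suc* n v u)
    where
    merge : ∀ x a b → (x - a) - b ≡ x - (a + b)
    merge = solve-∀
    shift : (x - + a) - + (n ℕ.* a) ≡ x - + (a ℕ.+ n ℕ.* a)
    shift = ≡.trans (merge x (+ a) (+ (n ℕ.* a))) (≡.cong (λ t → x - t) (≡.sym (ℤP.pos-+ a (n ℕ.* a))))

module PolynomialOperators (d : ℕ) where
  open import Data.Integer using (ℤ; +_; _+_; _*_)
  open import Algebra.Properties.Semiring.Exp ℤP.+-*-semiring using () renaming (_^_ to _^ℤ_)
  open import Algebra.Properties.CommutativeSemigroup ℤP.*-commutativeSemigroup using (x∙yz≈y∙xz)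
  open Operators (Vec ℤ d) public
  open Shifts

  translate : Vec ℕ d → ℤ → Op
  translate u a = record
    { apply      = λ e v → a * e (v −ᵥ u)
    ; apply-cong = λ e≗e′ v → ≡.cong (a *_) (e≗e′ (v −ᵥ u))
    ; apply-+    = λ e e′ v → ℤP.*-distribˡ-+ a (e (v −ᵥ u)) (e′ (v −ᵥ u))
    ; apply-0    = λ v → ℤP.*-zeroʳ a
    }

  ⟦_⟧ : Poly d → Op
  ⟦ [] ⟧          = 𝟘
  ⟦ (u , a) ∷ f ⟧ = translate u a ⊕ ⟦ f ⟧

  ⟦⟧-apply : ∀ f e v → apply ⟦ f ⟧ e v ≡ act f e v
  ⟦⟧-apply []            e v = ≡.refl
  ⟦⟧-apply ((u , a) ∷ f) e v = ≡.cong (λ t → a * e (v −ᵥ u) + t) (⟦⟧-apply f e v)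

  -- Monomial operators commute with every polynomial operator (the freshman's
  -- dream needs commuting summands).
  translate-comm : ∀ u a g → translate u a ⊛ ⟦ g ⟧ ≈ᵒ ⟦ g ⟧ ⊛ translate u a
  translate-comm u a []            e v = ℤP.*-zeroʳ a
  translate-comm u a ((w , b) ∷ g) e v = begin
    a * (b * e ((v −ᵥ u) −ᵥ w) + apply ⟦ g ⟧ e (v −ᵥ u))
      ≡⟨ ℤP.*-distribˡ-+ a _ _ ⟩
    a * (b * e ((v −ᵥ u) −ᵥ w)) + a * apply ⟦ g ⟧ e (v −ᵥ u)
      ≡⟨ ≡.cong₂ _+_ monomials (translate-comm u a g e v) ⟩
    b * (a * e ((v −ᵥ w) −ᵥ u)) + apply ⟦ g ⟧ (apply (translate u a) e) v ∎
    where
    open ≡.≡-Reasoning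
    monomials : a * (b * e ((v −ᵥ u) −ᵥ w)) ≡ b * (a * e ((v −ᵥ w) −ᵥ u))
    monomials = ≡.trans (≡.cong (λ t → a * (b * e t)) (−ᵥ-comm v u w)) (x∙yz≈y∙xz a b _)

  translate-^ : ∀ u a n → translate u a ^ n ≈ᵒ translate (map (n ℕ.*_) u) (a ^ℤ n)
  translate-^ u a zero    e v = ≡.sym (≡.trans (ℤP.*-identityˡ _) (≡.cong e (−ᵥ-0* v u)))
  translate-^ u a (suc n) e v = begin
    a * apply (translate u a ^ n) e (v −ᵥ u)       ≡⟨ ≡.cong (a *_) (translate-^ u a n e (v −ᵥ u)) ⟩
    a * (a ^ℤ n * e ((v −ᵥ u) −ᵥ map (n ℕ.*_) u))  ≡⟨ ℤP.*-assoc a _ _ ⟨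
    (a * a ^ℤ n) * e ((v −ᵥ u) −ᵥ map (n ℕ.*_) u)  ≡⟨ ≡.cong (λ w → (a * a ^ℤ n) * e w) (−ᵥ-suc* n v u) ⟩
    (a * a ^ℤ n) * e (v −ᵥ map (suc n ℕ.*_) u)     ∎
    where open ≡.≡-Reasoning

  translate-fermat : ∀ {p} → Prime p → ∀ w a → translate w (a ^ℤ p) ≈ translate w a mod p
  translate-fermat {p} pr w a with Fermat.fermat pr a
  ... | differBy k a^p≡a+pk = differBy (translate w k) λ e v → begin
    a ^ℤ p * e (v −ᵥ w)                          ≡⟨ ≡.cong (_* e (v −ᵥ w)) a^p≡a+pk′ ⟩
    (a + + p * k) * e (v −ᵥ w)                   ≡⟨ ℤP.*-distribʳ-+ (e (v −ᵥ w)) a _ ⟩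
    a * e (v −ᵥ w) + (+ p * k) * e (v −ᵥ w)      ≡⟨ ≡.cong (λ t → a * e (v −ᵥ w) + t) (ℤP.*-assoc (+ p) k _) ⟩
    a * e (v −ᵥ w) + + p * (k * e (v −ᵥ w))      ≡⟨ ≡.cong (λ t → a * e (v −ᵥ w) + t) (×-apply p (translate w k) e v) ⟨
    a * e (v −ᵥ w) + apply (p × translate w k) e v ∎
    where
    open ≡.≡-Reasoning
    a^p≡a+pk′ : a ^ℤ p ≡ a + + p * k
    a^p≡a+pk′ = ≡.trans a^p≡a+pk (≡.cong (λ t → a + t) (Fermat.×≡* p k))

  frobenius : ∀ {p} → Prime p → ∀ f → ⟦ f ⟧ ^ p ≈ ⟦ dilate p f ⟧ mod p
  frobenius {suc q} pr []            = ≈⇒≈mod (λ _ _ → ≡.refl)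
  frobenius {p}     pr ((u , a) ∷ g) = ≈mod-trans expand (≈mod-+ monomial (frobenius pr g))
    where
    expand : ⟦ (u , a) ∷ g ⟧ ^ p ≈ translate u a ^ p ⊕ ⟦ g ⟧ ^ p mod p
    expand = freshman (translate-comm u a g) pr
    monomial : translate u a ^ p ≈ translate (map (p ℕ.*_) u) a mod p
    monomial = ≈mod-trans (≈⇒≈mod (translate-^ u a p)) (translate-fermat pr _ a)

  ⟦⟧^-annihilates : ∀ f c → f ∈Ann c → ∀ n .{{_ : NonZero n}} v → apply (⟦ f ⟧ ^ n) c v ≡ + 0
  ⟦⟧^-annihilates f c ann 1               v = ≡.trans (⟦⟧-apply f c v) (ann v)
  ⟦⟧^-annihilates f c ann (suc n@(suc _)) v =
    ≡.trans (apply-cong ⟦ f ⟧ (⟦⟧^-annihilates f c ann n) v) (apply-0 ⟦ f ⟧ v)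

module Size where
  open import Data.Integer using (+_; _+_; _*_; -_; _-_; ∣_∣)
  import Data.List as List
  open import Data.List.Extrema.Nat using (max; xs≤max)
  open import Data.List.Membership.Propositional.Properties using (∈-map⁺)
  import Data.List.Relation.Unary.All as All

  weight : ∀ {d} → Poly d → ℕ
  weight []            = 0
  weight ((_ , a) ∷ f) = ∣ a ∣ ℕ.+ weight f

  weight-dilate : ∀ {d} n (f : Poly d) → weight (dilate n f) ≡ weight f
  weight-dilate n []            = ≡.refl
  weight-dilate n ((u , a) ∷ f) = ≡.cong (∣ a ∣ ℕ.+_) (weight-dilate n f)

  Bounded : ∀ {d} → Configuration d → ℕ → Set
  Bounded c M = ∀ v → ∣ c v ∣ ≤ M

  finitary⇒bounded : ∀ {d} {c : Configuration d} → Finitary c → ∃ λ M → Bounded c M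
  finitary⇒bounded (L , c∈L) =
    max 0 (List.map ∣_∣ L) , λ v → All.lookup (xs≤max 0 (List.map ∣_∣ L)) (∈-map⁺ ∣_∣ (c∈L v))

  act-bound : ∀ {d} {c : Configuration d} {M} → Bounded c M → ∀ f v → ∣ act f c v ∣ ≤ weight f ℕ.* M
  act-bound             c≤M []            v = ℕ.z≤n
  act-bound {c = c} {M} c≤M ((u , a) ∷ f) v = begin
    ∣ a * c (v −ᵥ u) + act f c v ∣             ≤⟨ ℤP.∣i+j∣≤∣i∣+∣j∣ (a * c (v −ᵥ u)) _ ⟩
    ∣ a * c (v −ᵥ u) ∣ ℕ.+ ∣ act f c v ∣       ≡⟨ ≡.cong (ℕ._+ ∣ act f c v ∣) (ℤP.abs-* a _) ⟩
    ∣ a ∣ ℕ.* ∣ c (v −ᵥ u) ∣ ℕ.+ ∣ act f c v ∣ ≤⟨ ℕP.+-mono-≤ (ℕP.*-monoʳ-≤ ∣ a ∣ (c≤M _)) (act-bound c≤M f v) ⟩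
    ∣ a ∣ ℕ.* M ℕ.+ weight f ℕ.* M             ≡⟨ ℕP.*-distribʳ-+ M ∣ a ∣ (weight f) ⟨
    (∣ a ∣ ℕ.+ weight f) ℕ.* M                 ∎
    where open ℕP.≤-Reasoning

  small-multiple≡0 : ∀ {x p k} → x + + p * k ≡ + 0 → ∣ x ∣ < p → x ≡ + 0
  small-multiple≡0 {x} {p} {k} x+pk≡0 ∣x∣<p = ℤP.∣i∣≡0⇒i≡0 (below p∣∣x∣ ∣x∣<p)
    where
    cancel : ∀ x y → x ≡ (x + y) - y
    cancel = solve-∀
    x≡-pk : x ≡ - (+ p * k)
    x≡-pk = ≡.trans (cancel x (+ p * k)) (≡.trans (≡.cong (_- (+ p * k)) x+pk≡0) (ℤP.+-identityˡ _))
    p∣∣x∣ : p ∣ ∣ x ∣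
    p∣∣x∣ = divides ∣ k ∣ (≡.trans (≡.cong ∣_∣ x≡-pk)
              (≡.trans (ℤP.∣-i∣≡∣i∣ (+ p * k)) (≡.trans (ℤP.abs-* (+ p) k) (ℕP.*-comm p ∣ k ∣))))
    below : ∀ {p n} → p ∣ n → n < p → n ≡ 0
    below {n = zero}  _   _   = ≡.refl
    below {n = suc n} p∣n n<p = contradiction (∣⇒≤ p∣n) (ℕP.<⇒≱ n<p)

module Dilation where
  open import Data.Vec.Properties using (map-cong; map-id; map-∘)

  dilate-1 : ∀ {d} (f : Poly d) → dilate 1 f ≡ f
  dilate-1 []            = ≡.refl
  dilate-1 ((u , a) ∷ f) =
    ≡.cong₂ (λ w g → (w , a) ∷ g) (≡.trans (map-cong ℕP.*-identityˡ u) (map-id u)) (dilate-1 f)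

  dilate-* : ∀ {d} m n (f : Poly d) → dilate (m ℕ.* n) f ≡ dilate n (dilate m f)
  dilate-* m n []            = ≡.refl
  dilate-* m n ((u , a) ∷ f) =
    ≡.cong₂ (λ w g → (w , a) ∷ g) (≡.trans (map-cong m*n*x≡n*[m*x] u) (map-∘ (n ℕ.*_) (m ℕ.*_) u))
            (dilate-* m n f)
    where
    m*n*x≡n*[m*x] : ∀ x → m ℕ.* n ℕ.* x ≡ n ℕ.* (m ℕ.* x)
    m*n*x≡n*[m*x] x = ≡.trans (≡.cong (ℕ._* x) (ℕP.*-comm m n)) (ℕP.*-assoc n m x)

module DilatingAnnihilators {d} (c : Configuration d) {M} (c≤M : Size.Bounded c M) where
  open import Data.Integer using (+_; _+_; _*_; ∣_∣)
  open import Data.Product using (_×_)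
  open PolynomialOperators d using (apply; ⟦_⟧; _^_; frobenius; ≈mod⇒pointwise; ⟦⟧-apply; ⟦⟧^-annihilates)
  open Size using (weight; weight-dilate; act-bound; small-multiple≡0)
  open Dilation

  -- Dilation by a prime p > weight f · M preserves annihilation of c: the values
  -- of f(X^p)·c are congruent mod p to those of f^p·c = 0, and smaller than p.
  dilate-prime : ∀ {p} f → Prime p → weight f ℕ.* M < p → f ∈Ann c → dilate p f ∈Ann c
  dilate-prime {p} f pr wM<p ann v with ≈mod⇒pointwise (frobenius pr f) c v
  ... | k , f^p≡f[X^p]+pk = small-multiple≡0 f[X^p]+pk≡0 small
    where
    f[X^p]+pk≡0 : act (dilate p f) c v + + p * k ≡ + 0
    f[X^p]+pk≡0 = begin
      act (dilate p f) c v + + p * k       ≡⟨ ≡.cong (_+ + p * k) (⟦⟧-apply (dilate p f) c v) ⟨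
      apply ⟦ dilate p f ⟧ c v + + p * k   ≡⟨ f^p≡f[X^p]+pk ⟨
      apply (⟦ f ⟧ ^ p) c v                ≡⟨ ⟦⟧^-annihilates f c ann p {{prime⇒nonZero pr}} v ⟩
      + 0                                  ∎
      where open ≡.≡-Reasoning
    small : ∣ act (dilate p f) c v ∣ < p
    small = ℕP.≤-<-trans (act-bound c≤M (dilate p f) v)
                         (≡.subst (λ w → w ℕ.* M < p) (≡.sym (weight-dilate p f)) wM<p)

  dilate-product : ∀ {B} ps → All (λ p → Prime p × B < p) ps →
                   ∀ f → weight f ℕ.* M ≤ B → f ∈Ann c → dilate (product ps) f ∈Ann c
  dilate-product     []       []                   f _    ann = ≡.subst (_∈Ann c) (≡.sym (dilate-1 f)) ann
  dilate-product {B} (p ∷ ps) ((pr , B<p) ∷ large) f wM≤B ann =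
    ≡.subst (_∈Ann c) (≡.sym (dilate-* p (product ps) f))
      (dilate-product ps large (dilate p f)
        (≡.subst (λ w → w ℕ.* M ≤ B) (≡.sym (weight-dilate p f)) wM≤B)
        (dilate-prime f pr (ℕP.≤-<-trans wM≤B B<p) ann))

  dilate-coprime : ∀ f → f ∈Ann c → ∀ n .{{_ : NonZero n}} →
                   Coprime n ((weight f ℕ.* M) !) → dilate n f ∈Ann c
  dilate-coprime f ann n n⊥B! = ≡.subst (λ m → dilate m f ∈Ann c) (≡.sym isFactorisation)
    (dilate-product factors (PrimeFactors.large-prime-factors factors factorsPrime factors⊥B!) f ℕP.≤-refl ann)
    where
    open PrimeFactorisation (factorise n)
    factors⊥B! : Coprime (product factors) ((weight f ℕ.* M) !)
    factors⊥B! = ≡.subst (λ m → Coprime m _) isFactorisation n⊥B!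

open import Data.Integer using (ℤ; +_; ∣_∣)
open import Data.Product using (_×_)
open import Relation.Binary.PropositionalEquality using (_≢_)

-- The theorem, with r = (weight f · M)! for a bound M of |c|.
mainTheorem7 : ∀ (d : ℕ) (c : Configuration d) (f : Poly d) →
    Finitary c → NonZeroPoly f → f ∈Ann c →
    ∃ λ (r : ℤ) → r ≢ + 0 × (∀ (n : ℕ) → NonZero n → Coprime n ∣ r ∣ → dilate n f ∈Ann c)
mainTheorem7 d c f finitary _ ann with Size.finitary⇒bounded finitary
... | M , c≤M = + (B !) , r≢0 , λ n n≢0 n⊥B! →
                  DilatingAnnihilators.dilate-coprime c c≤M f ann n {{n≢0}} n⊥B!
  where
  B : ℕ
  B = Size.weight f ℕ.* M
  r≢0 : + (B !) ≢ + 0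
  r≢0 r≡0 = ℕ.≢-nonZero⁻¹ (B !) {{ℕP._!≢0 B}} (ℤP.+-injective r≡0)
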